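{- Let $\mathbf{C}$ be an adhesive category which has all pushouts and has final pullback complements of all pairs $(b,c)$ with $c$ a monomorphism. Let $r_1: L_1 \xleftarrow{r_1^- } P_1 \xrightarrow{r_1^+} R_1$ be a rule and $m_1: L_1 \rightarrowtail G_1$ an instance, and let $G_1 \xleftarrow{g_1^- } G_1^- \xrightarrow{g_1^+} G_2$, with $m_1^-: P_1 \rightarrowtail G_1^-$ and $m_1^+: R_1 \rightarrowtail G_2$, be the SqPO rewriting of $G_1$ by $r_1$ through $m_1$. Assume this rewriting is reversible. Let $r_2: L_2 \xleftarrow{r_2^- } P_2 \xrightarrow{r_2^+} R_2$ be a rule and $m_2: L_2 \rightarrowtail G_2$ an instance, and let $G_2 \xleftarrow{g_2^- } G_2^- \xrightarrow{g_2^+} G_3$, with $m_2^-: P_2 \rightarrowtail G_2^-$ and $m_2^+ : R_2 \rightarrowtail G_3$, be the SqPO rewriting of $G_2$ by $r_2$ through $m_2$. Construct: (1) the pullback $R_1 \xleftarrow{x} D \xrightarrow{y} L_2$ of $m_1^+$ and $m_2$ (the overlap $o$); (2) the pushout $R_1 \xrightarrow{r_1^H} H \xleftarrow{l_2^H} L_2$ of $x$ and $y$, and the unique arrow $m^H: H \to G_2$ with $m^H\circ r_1^H = m_1^+$ and $m^H \circ l_2^H = m_2$; (3) the final pullback complement $P_1 \xrightarrow{p_1^H} P_1^H \xrightarrow{h_1^+} H$ of $(r_1^+, r_1^H)$, and the final pullback complement $P_2 \xrightarrow{p_2^H} P_2^H \xrightarrow{h_2^- } H$ of $(r_2^-, l_2^H)$;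 (4) the pushout $L_1 \xrightarrow{l_1^H} L \xleftarrow{h_1^- } P_1^H$ of $r_1^-$ and $p_1^H$, and the pushout $R_2 \xrightarrow{r_2^H} R \xleftarrow{h_2^+} P_2^H$ of $r_2^+$ and $p_2^H$; (5) the pullback $P_1^H \xleftarrow{p'} P \xrightarrow{p''} P_2^H$ of $h_1^+$ and $h_2^-$. The composed rule is $r: L \xleftarrow{h_1^-\circ p'} P \xrightarrow{h_2^+ \circ p''} R$. Let $m_1^H: P_1^H \to G_1^-$ be the unique arrow with $m_1^H \circ p_1^H = m_1^-$ and $g_1^+ \circ m_1^H = m^H \circ h_1^+$, and let $m: L \to G_1$ be the unique arrow with $m \circ l_1^H = m_1$ and $m \circ h_1^- = g_1^- \circ m_1^H$ (a monomorphism). Then the SqPO rewriting of $G_1$ by the rule $r$ through the instance $m$ produces $G_3$: there are $G_1 \xleftarrow{g^- } G_1^{\ominus} \xrightarrow{g^+} G_3$ and $m^-: P \rightarrowtail G_1^{\ominus}$, $m^+: R \rightarrowtail G_3$ such that $(m^-, g^-)$ is a final pullback complement of $(h_1^-\circ p', m)$ and $(m^+, g^+)$ is a pushout of $(m^-, h_2^+\circ p'')$.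
   Context: A final pullback complement (PBC) of a pair of arrows $b: A \to B$, $c: B \to C$ is a pair $a: A \to D$, $d: D \to C$ with $c \circ b = d \circ a$ such that this square is a pullback, and such that for every pullback square $c \circ b' = d' \circ a'$ (with $a': A' \to D'$, $b': A' \to B$, $d': D' \to C$) and every $e: A' \to A$ with $b \circ e = b'$ there is a unique $g: D' \to D$ with $g \circ a' = a \circ e$ and $d \circ g = d'$. A rule is a span $L \xleftarrow{r^- } P \xrightarrow{r^+} R$ in $\mathbf{C}$; an instance of it in an object $G$ is a monomorphism $m: L \rightarrowtail G$. The sesqui-pushout (SqPO) rewriting of $G$ by the rule through $m$ consists of: a final pullback complement $P \xrightarrow{m^- } G^- \xrightarrow{g^- } G$ of $(r^-, m)$, followed by the pushout $G^- \xrightarrow{g^+} G^+ \xleftarrow{m^+} R$ of $m^-$ and $r^+$; $G^+$ is the result, and $m^+$ is the right-hand side instance. Such a rewriting is reversible if the square $m\circ r^- = g^- \circ m^-$ is also a pushout and $(m^-, g^+)$ is also a final pullback complement of $(r^+, m^+)$. -}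

module Defs where

open import Level using (Level; _⊔_; suc)
open import Data.Product using (Σ; _×_; _,_; ∃; ∃-syntax)
open import Relation.Binary.PropositionalEquality using (_≡_)

record Category (o ℓ : Level) : Set (suc (o ⊔ ℓ)) where
  infixr 9 _∘_
  field
    Obj  : Set o
    Hom  : Obj → Obj → Set ℓ
    id   : ∀ {A} → Hom A A
    _∘_  : ∀ {A B C} → Hom B C → Hom A B → Hom A C
    assoc     : ∀ {A B C D} (h : Hom C D) (g : Hom B C) (f : Hom A B) →
                (h ∘ g) ∘ f ≡ h ∘ (g ∘ f)
    identityˡ : ∀ {A B} (f : Hom A B) → id ∘ f ≡ f
    identityʳ : ∀ {A B} (f : Hom A B) → f ∘ id ≡ f

module Notions {o ℓ : Level} (𝒞 : Category o ℓ) where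
  open Category 𝒞 public

  ∃!Hom : ∀ {X Y} → (Hom X Y → Set ℓ) → Set ℓ
  ∃!Hom {X} {Y} P = Σ (Hom X Y) λ u → P u × (∀ (v : Hom X Y) → P v → v ≡ u)

  Mono : ∀ {A B} → Hom A B → Set (o ⊔ ℓ)
  Mono {A} f = ∀ {X} (g h : Hom X A) → f ∘ g ≡ f ∘ h → g ≡ h

  record IsPullback {A B C P} (f : Hom A C) (g : Hom B C)
                    (p : Hom P A) (q : Hom P B) : Set (o ⊔ ℓ) where
    field
      commute   : f ∘ p ≡ g ∘ q
      universal : ∀ {X} (h : Hom X A) (k : Hom X B) → f ∘ h ≡ g ∘ k →
                  ∃!Hom {X} {P} (λ u → (p ∘ u ≡ h) × (q ∘ u ≡ k))

  record IsPushout {A B C Q} (f : Hom A B) (g : Hom A C)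
                   (i₁ : Hom B Q) (i₂ : Hom C Q) : Set (o ⊔ ℓ) where
    field
      commute   : i₁ ∘ f ≡ i₂ ∘ g
      universal : ∀ {X} (h : Hom B X) (k : Hom C X) → h ∘ f ≡ k ∘ g →
                  ∃!Hom {Q} {X} (λ u → (u ∘ i₁ ≡ h) × (u ∘ i₂ ≡ k))

  record IsFPC {A B C D} (b : Hom A B) (c : Hom B C)
               (a : Hom A D) (d : Hom D C) : Set (o ⊔ ℓ) where
    field
      pullback : IsPullback c d b a
      final    : ∀ {A' D'} (a' : Hom A' D') (b' : Hom A' B) (d' : Hom D' C) →
                 IsPullback c d' b' a' →
                 (e : Hom A' A) → b ∘ e ≡ b' →
                 ∃!Hom {D'} {D} (λ g → (g ∘ a' ≡ a ∘ e) × (d ∘ g ≡ d'))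

  HasPullbacks : Set (o ⊔ ℓ)
  HasPullbacks = ∀ {A B C} (f : Hom A C) (g : Hom B C) →
                 Σ Obj λ P → Σ (Hom P A) λ p → Σ (Hom P B) λ q → IsPullback f g p q

  HasPushouts : Set (o ⊔ ℓ)
  HasPushouts = ∀ {A B C} (f : Hom A B) (g : Hom A C) →
                Σ Obj λ Q → Σ (Hom B Q) λ i₁ → Σ (Hom C Q) λ i₂ → IsPushout f g i₁ i₂

  HasPushoutsAlongMonos : Set (o ⊔ ℓ)
  HasPushoutsAlongMonos = ∀ {A B C} (f : Hom A B) (g : Hom A C) → Mono f →
                Σ Obj λ Q → Σ (Hom B Q) λ i₁ → Σ (Hom C Q) λ i₂ → IsPushout f g i₁ i₂

  HasFPCsAlongMonos : Set (o ⊔ ℓ)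
  HasFPCsAlongMonos = ∀ {A B C} (b : Hom A B) (c : Hom B C) → Mono c →
                Σ Obj λ D → Σ (Hom A D) λ a → Σ (Hom D C) λ d → IsFPC b c a d

  -- Van Kampen property of the commutative square  i₁ ∘ f = i₂ ∘ g :
  -- for every commutative cube over it whose back faces are pullbacks,
  -- the top face is a pushout iff the front faces are pullbacks.
  IsVanKampen : ∀ {A B C D} (f : Hom A B) (g : Hom A C)
                (i₁ : Hom B D) (i₂ : Hom C D) → Set (o ⊔ ℓ)
  IsVanKampen {A} {B} {C} {D} f g i₁ i₂ =
    ∀ {A' B' C' D'} (f' : Hom A' B') (g' : Hom A' C')
      (i₁' : Hom B' D') (i₂' : Hom C' D')
      (a : Hom A' A) (b : Hom B' B) (c : Hom C' C) (d : Hom D' D) →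
      i₁' ∘ f' ≡ i₂' ∘ g' →
      b ∘ f' ≡ f ∘ a → c ∘ g' ≡ g ∘ a →
      d ∘ i₁' ≡ i₁ ∘ b → d ∘ i₂' ≡ i₂ ∘ c →
      IsPullback f b a f' → IsPullback g c a g' →
      ((IsPushout f' g' i₁' i₂' → (IsPullback i₁ d b i₁' × IsPullback i₂ d c i₂')) ×
       ((IsPullback i₁ d b i₁' × IsPullback i₂ d c i₂') → IsPushout f' g' i₁' i₂'))

  record Adhesive : Set (suc (o ⊔ ℓ)) where
    field
      pullbacks          : HasPullbacks
      pushoutsAlongMonos : HasPushoutsAlongMonos
      vanKampen          : ∀ {A B C D} (f : Hom A B) (g : Hom A C)
                           (i₁ : Hom B D) (i₂ : Hom C D) →
                           Mono f → IsPushout f g i₁ i₂ → IsVanKampen f g i₁ i₂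

{-# OPTIONS --safe #-}
module Submission where

-- Let H = R₁ +_D L₂ be the union of the instances m₁⁺ and m₂ in G₂; in an adhesive
-- category the induced arrow mᴴ : H → G₂ is mono.  Final pullback complements along
-- m₁⁺ = mᴴ ∘ r₁ᴴ and m₂ = mᴴ ∘ l₂ᴴ then split along mᴴ: by reversibility (m₁⁻, g₁⁺)
-- is an FPC of (r₁⁺, m₁⁺), so (m₁ᴴ, g₁⁺) is an FPC of (h₁⁺, mᴴ), and the FPC
-- (m₂⁻, g₂⁻) of the second step yields an FPC (m₂ᴴ, g₂⁻) of (h₂⁻, mᴴ).  Van Kampen
-- makes the square of m₁ᴴ and h₁⁺ a pushout as well.  As the first step is also a
-- pushout, so is the square of m₁ᴴ and h₁⁻ over m; it is along a mono, hence m is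
-- mono, and it is an FPC of (h₁⁻, m).  Pulling (m₂ᴴ, g₂⁻) back along g₁⁺ gives an
-- FPC with apex G₁⊖ = G₁⁻ ×_G₂ G₂⁻, which pasted with the latter is the FPC of the
-- composed rule.  Van Kampen over the pushout of m₁ᴴ and h₁⁺ makes the pulled-back
-- square a pushout, and pasting it with the pushout of m₂ᴴ and h₂⁺ contained in the
-- second step gives G₃.

open import Defs
open import Level using (Level)
open import Data.Product using (Σ; _×_; _,_; proj₁; proj₂)
open import Relation.Binary.PropositionalEquality
  using (_≡_; refl; sym; trans; cong; subst; subst₂; module ≡-Reasoning)

module CategoryProperties {o ℓ : Level} (𝒞 : Category o ℓ) where
  open Notions 𝒞
  open IsPullback renaming (commute to pb-commute; universal to pb-universal)
  open IsPushout renaming (commute to po-commute; universal to po-universal)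
  open IsFPC
  open ≡-Reasoning

  private
    variable
      A D D′ : Obj
      a a′ b b′ c c′ d d′ f f′ g g′ h k l p p′ q q′ r i₁ i₁′ i₂ j u v : Hom _ _

  pullˡ : f ∘ g ≡ h → f ∘ (g ∘ k) ≡ h ∘ k
  pullˡ {f = f} {g = g} {k = k} e = trans (sym (assoc f g k)) (cong (_∘ k) e)

  extendˡ : f ∘ g ≡ f′ ∘ g′ → f ∘ (g ∘ k) ≡ f′ ∘ (g′ ∘ k)
  extendˡ {f′ = f′} {g′ = g′} {k = k} e = trans (pullˡ e) (assoc f′ g′ k)

  extendʳ : f ∘ g ≡ f′ ∘ g′ → (k ∘ f) ∘ g ≡ (k ∘ f′) ∘ g′
  extendʳ {f = f} {g = g} {f′ = f′} {g′ = g′} {k = k} e =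
    trans (assoc k f g) (trans (cong (k ∘_) e) (sym (assoc k f′ g′)))

  cancelˡ : f ∘ g ≡ id → f ∘ (g ∘ k) ≡ k
  cancelˡ {k = k} e = trans (pullˡ e) (identityˡ k)

  id-mono : Mono (id {A})
  id-mono g h e = trans (sym (identityˡ g)) (trans e (identityˡ h))

  pullback-sym : IsPullback f g p q → IsPullback g f q p
  pullback-sym pb = record
    { commute = sym (pb-commute pb)
    ; universal = λ h k e →
        let (u , (pu , qu) , unique) = pb-universal pb k h (sym e)
        in u , (qu , pu) , λ v (qv , pv) → unique v (pv , qv)
    }

  pullback-jointly-mono : IsPullback f g p q → p ∘ u ≡ p ∘ v → q ∘ u ≡ q ∘ v → u ≡ v
  pullback-jointly-mono {p = p} {q = q} {u = u} {v = v} pb pu≡pv qu≡qv =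
    let (_ , _ , unique) = pb-universal pb (p ∘ u) (q ∘ u) (extendˡ (pb-commute pb))
    in trans (unique u (refl , refl)) (sym (unique v (sym pu≡pv , sym qu≡qv)))

  pullback-glue : IsPullback f g p q → IsPullback q k p′ q′ →
                  IsPullback f (g ∘ k) (p ∘ p′) q′
  pullback-glue {g = g} {p = p} {k = k} {p′ = p′} {q′ = q′} pb pb′ = record
    { commute = trans (extendˡ (pb-commute pb))
                  (trans (cong (g ∘_) (pb-commute pb′)) (sym (assoc g k q′)))
    ; universal = λ h h′ e →
        let (u , (pu , qu) , unique) = pb-universal pb h (k ∘ h′) (trans e (assoc g k h′))
            (u′ , (p′u′ , q′u′) , unique′) = pb-universal pb′ u h′ qu
        in u′ , (trans (assoc p p′ u′) (trans (cong (p ∘_) p′u′) pu) , q′u′) ,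
           λ v (pp′v , q′v) → unique′ v
             (unique (p′ ∘ v) (trans (sym (assoc p p′ v)) pp′v ,
                               trans (extendˡ (pb-commute pb′)) (cong (k ∘_) q′v)) ,
              q′v)
    }

  pullback-unglue : IsPullback f g p q → IsPullback f (g ∘ k) (p ∘ p′) q′ →
                    q ∘ p′ ≡ k ∘ q′ → IsPullback q k p′ q′
  pullback-unglue {g = g} {p = p} {k = k} {p′ = p′} pb outer e = record
    { commute = e
    ; universal = λ h h′ e′ →
        let (u , (pp′u , q′u) , unique) = pb-universal outer (p ∘ h) h′
              (trans (extendˡ (pb-commute pb)) (trans (cong (g ∘_) e′) (sym (assoc g k h′))))
        in u , (pullback-jointly-mono pb (trans (sym (assoc p p′ u)) pp′u)
                  (trans (extendˡ e) (trans (cong (k ∘_) q′u) (sym e′))) , q′u) ,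
           λ v (p′v , q′v) → unique v (trans (assoc p p′ v) (cong (p ∘_) p′v) , q′v)
    }

  mono-pullback-stable : IsPullback f g p q → Mono f → Mono q
  mono-pullback-stable {g = g} {p = p} pb mono-f u v qu≡qv =
    pullback-jointly-mono pb
      (mono-f (p ∘ u) (p ∘ v) (trans (extendˡ (pb-commute pb))
        (trans (cong (g ∘_) qu≡qv) (sym (extendˡ (pb-commute pb))))))
      qu≡qv

  triangle-pullback : Mono g → g ∘ h ≡ f → IsPullback f g id h
  triangle-pullback {g = g} {h = h} {f = f} mono-g gh≡f = record
    { commute = trans (identityʳ f) (sym gh≡f)
    ; universal = λ a b e →
        a , (identityˡ a , mono-g (h ∘ a) b (trans (pullˡ gh≡f) e)) ,
        λ v (v≡a , _) → trans (sym (identityˡ v)) v≡a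
    }

  pushout-sym : IsPushout f g i₁ i₂ → IsPushout g f i₂ i₁
  pushout-sym po = record
    { commute = sym (po-commute po)
    ; universal = λ h k e →
        let (u , (ui₁ , ui₂) , unique) = po-universal po k h (sym e)
        in u , (ui₂ , ui₁) , λ v (vi₂ , vi₁) → unique v (vi₁ , vi₂)
    }

  pushout-jointly-epi : IsPushout f g i₁ i₂ → u ∘ i₁ ≡ v ∘ i₁ → u ∘ i₂ ≡ v ∘ i₂ → u ≡ v
  pushout-jointly-epi {i₁ = i₁} {i₂ = i₂} {u = u} {v = v} po ui₁≡vi₁ ui₂≡vi₂ =
    let (_ , _ , unique) = po-universal po (u ∘ i₁) (u ∘ i₂) (extendʳ (po-commute po))
    in trans (unique u (refl , refl)) (sym (unique v (sym ui₁≡vi₁ , sym ui₂≡vi₂)))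

  pushout-glue : IsPushout f g i₁ i₂ → IsPushout f′ i₁ i₁′ j →
                 IsPushout (f′ ∘ f) g i₁′ (j ∘ i₂)
  pushout-glue {f = f} {g = g} {i₁ = i₁} {i₂ = i₂} {f′ = f′} {i₁′ = i₁′} {j = j} po po′ = record
    { commute = trans (extendˡ (po-commute po′))
                  (trans (cong (j ∘_) (po-commute po)) (sym (assoc j i₂ g)))
    ; universal = λ h k e →
        let (u , (ui₁ , ui₂) , unique) = po-universal po (h ∘ f′) k (trans (assoc h f′ f) e)
            (u′ , (u′i₁′ , u′j) , unique′) = po-universal po′ h u (sym ui₁)
        in u′ , (u′i₁′ , trans (sym (assoc u′ j i₂)) (trans (cong (_∘ i₂) u′j) ui₂)) ,
           λ v (vi₁′ , vji₂) → unique′ v (vi₁′ ,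
             unique (v ∘ j)
               (trans (extendʳ (sym (po-commute po′))) (cong (_∘ f′) vi₁′) ,
                trans (assoc v j i₂) vji₂))
    }

  pushout-unglue : IsPushout f g i₁ i₂ → IsPushout (f′ ∘ f) g i₁′ (j ∘ i₂) →
                   j ∘ i₁ ≡ i₁′ ∘ f′ → IsPushout f′ i₁ i₁′ j
  pushout-unglue {f = f} {g = g} {i₁ = i₁} {i₂ = i₂} {f′ = f′} {i₁′ = i₁′} {j = j} po outer e = record
    { commute = sym e
    ; universal = λ h k e′ →
        let (u , (ui₁′ , uji₂) , unique) = po-universal outer h (k ∘ i₂)
              (trans (sym (assoc h f′ f)) (trans (cong (_∘ f) e′) (extendʳ (po-commute po))))
        in u , (ui₁′ , pushout-jointly-epi po
                  (trans (assoc u j i₁) (trans (cong (u ∘_) e) (trans (sym (assoc u i₁′ f′))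
                    (trans (cong (_∘ f′) ui₁′) e′))))
                  (trans (assoc u j i₂) uji₂)) ,
           λ v (vi₁′ , vj) → unique v (vi₁′ , trans (sym (assoc v j i₂)) (cong (_∘ i₂) vj))
    }

  pushout-unglue-induced : IsPushout f g i₁ i₂ → IsPushout (k ∘ g) f j i₁′ →
                           Σ (Hom _ _) λ u → (u ∘ i₁ ≡ i₁′) × IsPushout k i₂ j u
  pushout-unglue-induced {f = f} {g = g} {i₁ = i₁} {i₂ = i₂} {k = k} {j = j} {i₁′ = i₁′} po outer =
    let (u , (ui₁ , ui₂) , _) = po-universal po i₁′ (j ∘ k)
          (trans (sym (po-commute outer)) (sym (assoc j k g)))
    in u , ui₁ ,
       pushout-unglue (pushout-sym po) (subst (IsPushout (k ∘ g) f j) (sym ui₁) outer) ui₂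

  id-pushout : IsPushout id g g id
  id-pushout {g = g} = record
    { commute = trans (identityʳ g) (sym (identityˡ g))
    ; universal = λ h k e →
        k , (trans (sym e) (identityʳ h) , identityʳ k) ,
        λ v (_ , v≡k) → trans (sym (identityʳ v)) v≡k
    }

  record _≅_ (A B : Obj) : Set ℓ where
    field
      from : Hom A B
      to   : Hom B A
      isoˡ : to ∘ from ≡ id
      isoʳ : from ∘ to ≡ id

  fpc-mediator : IsFPC b c a d → IsPullback c d′ b a′ →
                 Σ (Hom _ _) λ u → (u ∘ a′ ≡ a) × (d ∘ u ≡ d′)
  fpc-mediator {b = b} {a = a} {d′ = d′} {a′ = a′} F pb =
    let (u , (ua′ , du) , _) = final F a′ b d′ pb id (identityʳ b)
    in u , trans ua′ (identityʳ a) , du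

  fpc-endo-id : IsFPC b c a d → u ∘ a ≡ a → d ∘ u ≡ d → u ≡ id
  fpc-endo-id {b = b} {a = a} {d = d} {u = u} F ua≡a du≡d =
    let (_ , _ , unique) = final F a b d (pullback F) id (identityʳ b)
    in trans (unique u (trans ua≡a (sym (identityʳ a)) , du≡d))
             (sym (unique id (trans (identityˡ a) (sym (identityʳ a)) , identityʳ d)))

  fpc-transfer : IsFPC b c a d → (i : D ≅ D′) → d′ ∘ _≅_.from i ≡ d →
                 IsFPC b c (_≅_.from i ∘ a) d′
  fpc-transfer {b = b} {c = c} {a = a} {d = d} {d′ = d′} F i d′from≡d = record
    { pullback = record
      { commute = trans (pb-commute (pullback F))
                    (trans (cong (_∘ a) (sym d′from≡d)) (assoc d′ from a))
      ; universal = λ h k e →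
          let (u , (bu , au) , unique) = pb-universal (pullback F) h (to ∘ k) (trans e (d′≡d∘to k))
          in u , (bu , trans (assoc from a u) (trans (cong (from ∘_) au) (cancelˡ isoʳ))) ,
             λ v (bv , fromav) → unique v
               (bv , trans (sym (cancelˡ isoˡ)) (cong (to ∘_) (trans (sym (assoc from a v)) fromav)))
      }
    ; final = λ a″ b″ d″ pb e be →
        let (u , (ua″ , du) , unique) = final F a″ b″ d″ pb e be
        in from ∘ u ,
           (trans (assoc from u a″) (trans (cong (from ∘_) ua″) (sym (assoc from a e))) ,
            trans (pullˡ d′from≡d) du) ,
           λ v (va″ , d′v) → trans (sym (cancelˡ isoʳ)) (cong (from ∘_) (unique (to ∘ v)
             (trans (assoc to v a″) (trans (cong (to ∘_) (trans va″ (assoc from a e))) (cancelˡ isoˡ)) ,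
              trans (sym (d′≡d∘to v)) d′v)))
    }
    where
    open _≅_ i
    d′≡d∘to : ∀ {X} (k : Hom X _) → d′ ∘ k ≡ d ∘ (to ∘ k)
    d′≡d∘to k = trans (cong (d′ ∘_) (sym (cancelˡ isoʳ))) (pullˡ d′from≡d)

  fpc-unique : IsFPC b c a d → IsFPC b c a′ d′ →
               Σ (D ≅ D′) λ i → (_≅_.from i ∘ a ≡ a′) × (d′ ∘ _≅_.from i ≡ d)
  fpc-unique {a = a} {a′ = a′} F F′ =
    let (u , ua≡a′ , d′u≡d) = fpc-mediator F′ (pullback F)
        (v , va′≡a , dv≡d′) = fpc-mediator F (pullback F′)
    in record
         { from = u
         ; to = v
         ; isoˡ = fpc-endo-id F (trans (assoc v u a) (trans (cong (v ∘_) ua≡a′) va′≡a))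
                                (trans (pullˡ dv≡d′) d′u≡d)
         ; isoʳ = fpc-endo-id F′ (trans (assoc u v a′) (trans (cong (u ∘_) va′≡a) ua≡a′))
                                 (trans (pullˡ d′u≡d) dv≡d′)
         } ,
       ua≡a′ , d′u≡d

  -- The FPC of (b, c) that exists because c is mono provides an inverse of the
  -- mediator given by the finality of F.
  fpc-cancel : HasFPCsAlongMonos → Mono c → IsPullback b l p r → IsPullback c d b a →
               IsFPC r (c ∘ l) (a ∘ p) d → IsFPC b c a d
  fpc-cancel {c = c} {b = b} {p = p} {d = d} {a = a} fpcs mono-c pb-left pb-right F =
    let (_ , a′ , d′ , F′) = fpcs b c mono-c
        (u , ua′p≡ap , du≡d′) = fpc-mediator F
          (pullback-sym (pullback-glue (pullback-sym (pullback F′)) pb-left))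
        (v , va≡a′ , d′v≡d) = fpc-mediator F′ pb-right
        uv≡id = fpc-endo-id F (trans (assoc u v (a ∘ p)) (trans (cong (u ∘_) (pullˡ va≡a′)) ua′p≡ap))
                              (trans (pullˡ du≡d′) d′v≡d)
        ua′≡a = trans (cong (u ∘_) (sym va≡a′)) (cancelˡ uv≡id)
        vu≡id = fpc-endo-id F′ (trans (assoc v u a′) (trans (cong (v ∘_) ua′≡a) va≡a′))
                               (trans (pullˡ d′v≡d) du≡d′)
    in subst (λ x → IsFPC b c x d) ua′≡a
         (fpc-transfer F′ (record { from = u ; to = v ; isoˡ = vu≡id ; isoʳ = uv≡id }) du≡d′)

  fpc-pasteᵇ : IsFPC b c a d → IsFPC b′ c′ c d′ → IsFPC (b′ ∘ b) c′ a (d′ ∘ d)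
  fpc-pasteᵇ {b = b} {c = c} {a = a} {d = d} {b′ = b′} {c′ = c′} {d′ = d′} F F′ = record
    { pullback = pullback-glue (pullback F′) (pullback F)
    ; final = λ a″ b″ d″ pb e be →
        let b′be≡b″ = trans (sym (assoc b′ b e)) be
            (u′ , (u′a″ , d′u′) , unique′) = final F′ a″ b″ d″ pb (b ∘ e) b′be≡b″
            pb′ = pullback-unglue (pullback F′)
                    (subst₂ (λ x y → IsPullback c′ x y a″) (sym d′u′) (sym b′be≡b″) pb)
                    (sym u′a″)
            (u , (ua″ , du) , unique) = final F a″ (b ∘ e) u′ pb′ e refl
        in u , (ua″ , trans (assoc d′ d u) (trans (cong (d′ ∘_) du) d′u′)) ,
           λ v (va″ , d′dv) → unique v (va″ , unique′ (d ∘ v)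
             (trans (assoc d v a″) (trans (cong (d ∘_) va″) (sym (extendˡ (pb-commute (pullback F))))) ,
              trans (sym (assoc d′ d v)) d′dv))
    }

  fpc-pullback-stable : ∀ {A B C D A′ B′ C′} {b : Hom A B} {c : Hom B C} {a : Hom A D} {d : Hom D C}
    {z : Hom C′ C} {β : Hom B′ B} {c′ : Hom B′ C′} {δ : Hom D′ D} {d′ : Hom D′ C′}
    {α : Hom A′ A} {b′ : Hom A′ B′} →
    IsFPC b c a d → IsPullback c z β c′ → IsPullback d z δ d′ → IsPullback b β α b′ →
    Σ (Hom A′ D′) λ a′ → (δ ∘ a′ ≡ a ∘ α) × (d′ ∘ a′ ≡ c′ ∘ b′) × IsFPC b′ c′ a′ d′
  fpc-pullback-stable {b = b} {c} {a} {d} {z} {β} {c′} {δ} {d′} {α} {b′} F pb-c pb-d pb-b =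
    â , δâ≡aα , d′â≡c′b′ , record
    { pullback = record
      { commute = sym d′â≡c′b′
      ; universal = λ h k e →
          let (v , (bv , av) , unique-v) = pb-universal (pullback F) (β ∘ h) (δ ∘ k)
                (trans (extendˡ (pb-commute pb-c))
                  (trans (cong (z ∘_) e) (sym (extendˡ (pb-commute pb-d)))))
              (w , (αw , b′w) , unique-w) = pb-universal pb-b v h bv
          in w , (b′w , pullback-jointly-mono pb-d
                   (trans (extendˡ δâ≡aα) (trans (cong (a ∘_) αw) av))
                   (trans (extendˡ d′â≡c′b′) (trans (cong (c′ ∘_) b′w) e))) ,
             λ w′ (b′w′ , a′w′) → unique-w w′ (unique-v (α ∘ w′)
               (trans (extendˡ (pb-commute pb-b)) (cong (β ∘_) b′w′) ,
                trans (sym (extendˡ δâ≡aα)) (cong (δ ∘_) a′w′)) , b′w′)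
      }
    ; final = λ a″ b″ d″ pb e be →
        let (u , (ua″ , du) , unique-u) = final F a″ (β ∘ b″) (z ∘ d″) (pullback-glue pb-c pb) (α ∘ e)
                (trans (extendˡ (pb-commute pb-b)) (cong (β ∘_) be))
            (g , (δg , d′g) , unique-g) = pb-universal pb-d u d″ du
        in g , (pullback-jointly-mono pb-d
                  (trans (pullˡ δg) (trans ua″ (sym (extendˡ δâ≡aα))))
                  (trans (pullˡ d′g) (trans (sym (pb-commute pb))
                    (trans (cong (c′ ∘_) (sym be)) (sym (extendˡ d′â≡c′b′))))) , d′g) ,
           λ g′ (g′a″ , d′g′) → unique-g g′ (unique-u (δ ∘ g′)
             (trans (assoc δ g′ a″) (trans (cong (δ ∘_) g′a″) (extendˡ δâ≡aα)) ,
              trans (extendˡ (pb-commute pb-d)) (cong (z ∘_) d′g′)) , d′g′)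
    }
    where
    mediator = pb-universal pb-d (a ∘ α) (c′ ∘ b′) (begin
      d ∘ (a ∘ α)   ≡⟨ sym (extendˡ (pb-commute (pullback F))) ⟩
      c ∘ (b ∘ α)   ≡⟨ cong (c ∘_) (pb-commute pb-b) ⟩
      c ∘ (β ∘ b′)  ≡⟨ extendˡ (pb-commute pb-c) ⟩
      z ∘ (c′ ∘ b′) ∎)
    â = proj₁ mediator
    δâ≡aα = proj₁ (proj₁ (proj₂ mediator))
    d′â≡c′b′ = proj₂ (proj₁ (proj₂ mediator))

module AdhesiveProperties {o ℓ : Level} {𝒞 : Category o ℓ} (adhesive : Notions.Adhesive 𝒞) where
  open Notions 𝒞
  open CategoryProperties 𝒞
  open Adhesive adhesive
  open IsPullback renaming (commute to pb-commute; universal to pb-universal)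
  open IsPushout renaming (commute to po-commute)
  open IsFPC
  open ≡-Reasoning

  private
    variable
      a′ a₁ b c₁ c₂ d d′ d₁ f f₁ f₂ g h k m m₁ m₂ p₁ p₂ q₁ q₂ i₁ i₂ i₂′ j₁ u v x y : Hom _ _

  private
    pushout-along-mono-front-faces : Mono f → IsPushout f g i₁ i₂ →
                                     IsPullback i₁ i₂ f g × IsPullback i₂ i₂ id id
    pushout-along-mono-front-faces {f = f} {g = g} {i₁ = i₁} {i₂ = i₂} mono-f po =
      proj₁ (vanKampen f g i₁ i₂ mono-f po id g g id id f id i₂
               (trans (identityʳ g) (sym (identityˡ g))) refl
               (trans (identityˡ g) (sym (identityʳ g))) (sym (po-commute po)) refl
               (triangle-pullback mono-f (identityʳ f)) (triangle-pullback id-mono (identityˡ g)))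
            id-pushout

  pushout-along-mono-is-pullback : Mono f → IsPushout f g i₁ i₂ → IsPullback i₁ i₂ f g
  pushout-along-mono-is-pullback mono-f po = proj₁ (pushout-along-mono-front-faces mono-f po)

  pushout-preserves-mono : Mono f → IsPushout f g i₁ i₂ → Mono i₂
  pushout-preserves-mono mono-f po u v e =
    let (_ , (w≡u , w≡v) , _) = pb-universal (proj₂ (pushout-along-mono-front-faces mono-f po)) u v e
    in trans (sym w≡u) w≡v

  -- The pullback of a pushout along a mono is again a pushout (Van Kampen).
  pullbacks-of-injections-jointly-epi : Mono f → IsPushout f g i₁ i₂ →
    IsPullback h i₁ p₁ q₁ → IsPullback h i₂ p₂ q₂ → u ∘ p₁ ≡ v ∘ p₁ → u ∘ p₂ ≡ v ∘ p₂ → u ≡ v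
  pullbacks-of-injections-jointly-epi {f = f} {g = g} {i₁ = i₁} {i₂ = i₂} {h = h} {p₁ = p₁} {q₁ = q₁}
                                      {p₂ = p₂} {q₂ = q₂} mono-f po pb₁ pb₂ =
    let (_ , s , t , pb₀) = pullbacks q₁ f
        (r , (p₂r , q₂r) , _) = pb-universal pb₂ (p₁ ∘ s) (g ∘ t) (begin
          h ∘ (p₁ ∘ s)  ≡⟨ extendˡ (pb-commute pb₁) ⟩
          i₁ ∘ (q₁ ∘ s) ≡⟨ cong (i₁ ∘_) (pb-commute pb₀) ⟩
          i₁ ∘ (f ∘ t)  ≡⟨ extendˡ (po-commute po) ⟩
          i₂ ∘ (g ∘ t)  ∎)
        back = pullback-unglue pb₂
                 (subst₂ (λ x y → IsPullback h x y t) (po-commute po) (sym p₂r) (pullback-glue pb₁ pb₀))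
                 q₂r
        top = proj₂ (vanKampen f g i₁ i₂ mono-f po s r p₁ p₂ t q₁ q₂ h
                (sym p₂r) (pb-commute pb₀) q₂r (pb-commute pb₁) (pb-commute pb₂)
                (pullback-sym pb₀) (pullback-sym back))
              (pullback-sym pb₁ , pullback-sym pb₂)
    in pushout-jointly-epi top

  union-factor : Mono m₁ → Mono m₂ → IsPullback m₁ m₂ x y → IsPushout x y i₁ i₂ →
                 m ∘ i₁ ≡ m₁ → m ∘ i₂ ≡ m₂ → m ∘ k ≡ m₁ ∘ h → k ≡ i₁ ∘ h
  union-factor {m₁ = m₁} {m₂ = m₂} {x = x} {y = y} {i₁ = i₁} {i₂ = i₂} {m = m} {k = k} {h = h}
               mono-m₁ mono-m₂ pb po mi₁ mi₂ mk≡m₁h =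
    let (_ , p₁ , q₁ , pb₁) = pullbacks k i₁
        (_ , p₂ , q₂ , pb₂) = pullbacks k i₂
    in pullbacks-of-injections-jointly-epi (mono-pullback-stable (pullback-sym pb) mono-m₂) po pb₁ pb₂
         (on-R pb₁) (on-L pb₂)
    where
    on-R : ∀ {X p₁ q₁} → IsPullback {P = X} k i₁ p₁ q₁ → k ∘ p₁ ≡ (i₁ ∘ h) ∘ p₁
    on-R {p₁ = p₁} {q₁} pb₁ = begin
      k ∘ p₁         ≡⟨ pb-commute pb₁ ⟩
      i₁ ∘ q₁        ≡⟨ cong (i₁ ∘_) q₁≡hp₁ ⟩
      i₁ ∘ (h ∘ p₁)  ≡⟨ sym (assoc i₁ h p₁) ⟩
      (i₁ ∘ h) ∘ p₁  ∎
      where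
      q₁≡hp₁ = mono-m₁ q₁ (h ∘ p₁) (begin
        m₁ ∘ q₁        ≡⟨ sym (pullˡ mi₁) ⟩
        m ∘ (i₁ ∘ q₁)  ≡⟨ cong (m ∘_) (sym (pb-commute pb₁)) ⟩
        m ∘ (k ∘ p₁)   ≡⟨ extendˡ mk≡m₁h ⟩
        m₁ ∘ (h ∘ p₁)  ∎)
    on-L : ∀ {X p₂ q₂} → IsPullback {P = X} k i₂ p₂ q₂ → k ∘ p₂ ≡ (i₁ ∘ h) ∘ p₂
    on-L {p₂ = p₂} {q₂} pb₂ =
      let (w , (xw , yw) , _) = pb-universal pb (h ∘ p₂) q₂ (begin
            m₁ ∘ (h ∘ p₂)  ≡⟨ sym (extendˡ mk≡m₁h) ⟩
            m ∘ (k ∘ p₂)   ≡⟨ cong (m ∘_) (pb-commute pb₂) ⟩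
            m ∘ (i₂ ∘ q₂)  ≡⟨ pullˡ mi₂ ⟩
            m₂ ∘ q₂        ∎)
      in begin
        k ∘ p₂         ≡⟨ pb-commute pb₂ ⟩
        i₂ ∘ q₂        ≡⟨ cong (i₂ ∘_) (sym yw) ⟩
        i₂ ∘ (y ∘ w)   ≡⟨ sym (extendˡ (po-commute po)) ⟩
        i₁ ∘ (x ∘ w)   ≡⟨ cong (i₁ ∘_) xw ⟩
        i₁ ∘ (h ∘ p₂)  ≡⟨ sym (assoc i₁ h p₂) ⟩
        (i₁ ∘ h) ∘ p₂  ∎

  union-mono : Mono m₁ → Mono m₂ → IsPullback m₁ m₂ x y → IsPushout x y i₁ i₂ →
               m ∘ i₁ ≡ m₁ → m ∘ i₂ ≡ m₂ → Mono m
  union-mono {m₁ = m₁} {m₂ = m₂} {i₁ = i₁} {i₂ = i₂} {m = m} mono-m₁ mono-m₂ pb po mi₁ mi₂ u v mu≡mv =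
    let (_ , p₁ , q₁ , pb₁) = pullbacks u i₁
        (_ , p₂ , q₂ , pb₂) = pullbacks u i₂
    in pullbacks-of-injections-jointly-epi (mono-pullback-stable (pullback-sym pb) mono-m₂) po pb₁ pb₂
         (trans (pb-commute pb₁)
           (sym (union-factor mono-m₁ mono-m₂ pb po mi₁ mi₂ (m∘v≡ mi₁ pb₁))))
         (trans (pb-commute pb₂)
           (sym (union-factor mono-m₂ mono-m₁ (pullback-sym pb) (pushout-sym po) mi₂ mi₁ (m∘v≡ mi₂ pb₂))))
    where
    m∘v≡ : ∀ {X Z} {i : Hom Z _} {n : Hom Z _} {p : Hom X _} {q : Hom X Z} →
           m ∘ i ≡ n → IsPullback u i p q → m ∘ (v ∘ p) ≡ n ∘ q
    m∘v≡ {i = i} {n} {p} {q} mi≡n pb′ = begin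
      m ∘ (v ∘ p)  ≡⟨ pullˡ (sym mu≡mv) ⟩
      (m ∘ u) ∘ p  ≡⟨ assoc m u p ⟩
      m ∘ (u ∘ p)  ≡⟨ cong (m ∘_) (pb-commute pb′) ⟩
      m ∘ (i ∘ q)  ≡⟨ pullˡ mi≡n ⟩
      n ∘ q        ∎

  pushout-restrict : Mono f → IsPushout f g i₁ i₂ → Mono d →
                     f₂ ∘ f₁ ≡ f → d ∘ i₂′ ≡ i₂ → j₁ ∘ f₁ ≡ i₂′ ∘ g →
                     IsPullback i₁ d f₂ j₁ → IsPushout f₂ j₁ i₁ d
  pushout-restrict {f = f} {g = g} {i₁ = i₁} {i₂ = i₂} {d = d} {f₂ = f₂} {f₁ = f₁} {i₂′ = i₂′} {j₁ = j₁}
                   mono-f po mono-d f₂f₁≡f di₂′≡i₂ j₁f₁≡i₂′g pb =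
    pushout-unglue restricted
      (subst₂ (λ x y → IsPushout x g i₁ y) (sym f₂f₁≡f) (sym di₂′≡i₂) po)
      (sym (pb-commute pb))
    where
    restricted : IsPushout f₁ g j₁ i₂′
    restricted = proj₂ (vanKampen f g i₁ i₂ mono-f po f₁ g j₁ i₂′ id f₂ id d
                   j₁f₁≡i₂′g (trans f₂f₁≡f (sym (identityʳ f))) (trans (identityˡ g) (sym (identityʳ g)))
                   (sym (pb-commute pb)) (trans di₂′≡i₂ (sym (identityʳ i₂)))
                   (triangle-pullback (mono-pullback-stable (pullback-sym pb) mono-d) f₂f₁≡f)
                   (triangle-pullback id-mono (identityˡ g)))
                 (pb , triangle-pullback mono-d di₂′≡i₂)

  -- Pulling c₂ back along d′ splits a pullback square over c₂ ∘ c₁ into two,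
  -- to which the finality of F₁ and then of F₂ applies.
  fpc-pasteᶜ : IsFPC b c₁ a₁ d₁ → IsFPC d₁ c₂ u d → IsFPC b (c₂ ∘ c₁) (u ∘ a₁) d
  fpc-pasteᶜ {b = b} {c₁ = c₁} {a₁ = a₁} {d₁ = d₁} {c₂ = c₂} {u = u} {d = d} F₁ F₂ = record
    { pullback = pullback-sym (pullback-glue (pullback-sym (pullback F₂)) (pullback-sym (pullback F₁)))
    ; final = λ a′ b′ d′ pb e be →
        let (_ , δ₁ , δ₂ , pb-δ) = pullbacks c₂ d′
            (ι , (δ₁ι , δ₂ι) , _) = pb-universal pb-δ (c₁ ∘ b′) a′
                                      (trans (sym (assoc c₂ c₁ b′)) (pb-commute pb))
            pb-ι = pullback-sym (pullback-unglue (pullback-sym pb-δ)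
                     (subst (λ x → IsPullback d′ (c₂ ∘ c₁) x b′) (sym δ₂ι) (pullback-sym pb)) δ₁ι)
            (g₁ , (g₁ι , d₁g₁) , unique₁) = final F₁ ι b′ δ₁ pb-ι e be
            (g , (gδ₂ , dg) , unique₂) = final F₂ δ₂ δ₁ d′ pb-δ g₁ d₁g₁
        in g , ((begin
                  g ∘ a′           ≡⟨ cong (g ∘_) (sym δ₂ι) ⟩
                  g ∘ (δ₂ ∘ ι)     ≡⟨ pullˡ gδ₂ ⟩
                  (u ∘ g₁) ∘ ι     ≡⟨ assoc u g₁ ι ⟩
                  u ∘ (g₁ ∘ ι)     ≡⟨ cong (u ∘_) g₁ι ⟩
                  u ∘ (a₁ ∘ e)     ≡⟨ sym (assoc u a₁ e) ⟩
                  (u ∘ a₁) ∘ e     ∎) , dg) ,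
           λ g′ (g′a′ , dg′) →
             let (w , (d₁w , uw) , _) = pb-universal (pullback F₂) δ₁ (g′ ∘ δ₂)
                                          (trans (pb-commute pb-δ) (sym (pullˡ dg′)))
                 wι≡a₁e = pullback-jointly-mono (pullback F₂)
                   (trans (pullˡ d₁w) (trans δ₁ι (trans (cong (c₁ ∘_) (sym be))
                     (extendˡ (pb-commute (pullback F₁))))))
                   (trans (pullˡ uw) (trans (assoc g′ δ₂ ι) (trans (cong (g′ ∘_) δ₂ι)
                     (trans g′a′ (assoc u a₁ e)))))
             in unique₂ g′ (trans (sym uw) (cong (u ∘_) (unique₁ w (wι≡a₁e , d₁w))) , dg′)
    }

  fpc-factor : HasFPCsAlongMonos → IsFPC b c₁ a₁ d₁ → IsFPC b (c₂ ∘ c₁) a′ d′ → Mono c₂ →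
               Σ (Hom _ _) λ u → (u ∘ a₁ ≡ a′) × IsFPC d₁ c₂ u d′
  fpc-factor {a₁ = a₁} {d₁ = d₁} {c₂ = c₂} fpcs F₁ F′ mono-c₂ =
    let (_ , a , _ , F) = fpcs d₁ c₂ mono-c₂
        (i , iaa₁≡a′ , d′i≡d) = fpc-unique (fpc-pasteᶜ F₁ F) F′
    in _≅_.from i ∘ a , trans (assoc _ a a₁) iaa₁≡a′ , fpc-transfer F i d′i≡d

  fpc-factor-unique : HasFPCsAlongMonos → IsFPC b c₁ a₁ d₁ → IsFPC b (c₂ ∘ c₁) a′ d′ → Mono c₂ →
                      u ∘ a₁ ≡ a′ → d′ ∘ u ≡ c₂ ∘ d₁ → IsFPC d₁ c₂ u d′
  fpc-factor-unique {a₁ = a₁} {d₁ = d₁} {c₂ = c₂} {d′ = d′} {u = u} fpcs F₁ F′ mono-c₂ ua₁≡a′ d′u≡c₂d₁ =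
    let (u₀ , u₀a₁≡a′ , F₀) = fpc-factor fpcs F₁ F′ mono-c₂
        (t , (d₁t≡d₁ , u₀t≡u) , _) = pb-universal (pullback F₀) d₁ u (sym d′u≡c₂d₁)
        ta₁≡a₁ = mono-pullback-stable (pullback F₀) mono-c₂ (t ∘ a₁) a₁
                   (trans (pullˡ u₀t≡u) (trans ua₁≡a′ (sym u₀a₁≡a′)))
        u₀≡u = trans (sym (identityʳ u₀)) (trans (cong (u₀ ∘_) (sym (fpc-endo-id F₁ ta₁≡a₁ d₁t≡d₁))) u₀t≡u)
    in subst (λ x → IsFPC d₁ c₂ x d′) u₀≡u F₀

  concurrent-composition :
    ∀ {L G₁ G₁⁻ G₂ G₂⁻ G₃ H R P₁ᴴ P₂ᴴ P}
      {h₁⁻ : Hom P₁ᴴ L} {m : Hom L G₁} {m₁ᴴ : Hom P₁ᴴ G₁⁻} {g₁⁻ : Hom G₁⁻ G₁}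
      {h₁⁺ : Hom P₁ᴴ H} {mᴴ : Hom H G₂} {g₁⁺ : Hom G₁⁻ G₂}
      {h₂⁻ : Hom P₂ᴴ H} {m₂ᴴ : Hom P₂ᴴ G₂⁻} {g₂⁻ : Hom G₂⁻ G₂}
      {h₂⁺ : Hom P₂ᴴ R} {g₂⁺ : Hom G₂⁻ G₃} {m⁺ : Hom R G₃}
      {p′ : Hom P P₁ᴴ} {p″ : Hom P P₂ᴴ} →
    IsFPC h₁⁻ m m₁ᴴ g₁⁻ → Mono m₁ᴴ → IsPushout m₁ᴴ h₁⁺ g₁⁺ mᴴ →
    IsFPC h₂⁻ mᴴ m₂ᴴ g₂⁻ → IsPushout m₂ᴴ h₂⁺ g₂⁺ m⁺ → IsPullback h₁⁺ h₂⁻ p′ p″ →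
    Σ Obj λ G₁⊖ → Σ (Hom G₁⊖ G₁) λ g⁻ → Σ (Hom P G₁⊖) λ m⁻ → Σ (Hom G₁⊖ G₃) λ g⁺ →
      Mono m⁻ × IsFPC (h₁⁻ ∘ p′) m m⁻ g⁻ × IsPushout m⁻ (h₂⁺ ∘ p″) g⁺ m⁺
  concurrent-composition {m₁ᴴ = m₁ᴴ} {g₁⁻ = g₁⁻} {h₁⁺ = h₁⁺} {mᴴ = mᴴ} {g₁⁺ = g₁⁺} {h₂⁻ = h₂⁻}
                         {m₂ᴴ = m₂ᴴ} {g₂⁻ = g₂⁻} {g₂⁺ = g₂⁺} {p′ = p′} {p″ = p″}
                         fpc-h₁⁻ mono-m₁ᴴ po-m₁ᴴ-h₁⁺ fpc-h₂⁻ po-m₂ᴴ-h₂⁺ pb-P =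
    let (G₁⊖ , k₁ , k₂ , pb-G₁⊖) = pullbacks g₁⁺ g₂⁻
        (m⁻ , k₂m⁻ , k₁m⁻ , fpc-p′) = fpc-pullback-stable fpc-h₂⁻
          (pullback-sym (pushout-along-mono-is-pullback mono-m₁ᴴ po-m₁ᴴ-h₁⁺))
          (pullback-sym pb-G₁⊖) (pullback-sym pb-P)
        po-m⁻-p″ = proj₂ (vanKampen m₁ᴴ h₁⁺ g₁⁺ mᴴ mono-m₁ᴴ po-m₁ᴴ-h₁⁺ m⁻ p″ k₂ m₂ᴴ p′ k₁ h₂⁻ g₂⁻
                     k₂m⁻ k₁m⁻ (sym (pb-commute pb-P)) (sym (pb-commute pb-G₁⊖))
                     (sym (pb-commute (pullback fpc-h₂⁻))) (pullback fpc-p′) pb-P)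
                   (pb-G₁⊖ , pullback fpc-h₂⁻)
    in G₁⊖ , g₁⁻ ∘ k₁ , m⁻ , g₂⁺ ∘ k₂ ,
       mono-pullback-stable (pullback fpc-p′) mono-m₁ᴴ ,
       fpc-pasteᵇ fpc-p′ fpc-h₁⁻ ,
       pushout-sym (pushout-glue (pushout-sym po-m⁻-p″) (pushout-sym po-m₂ᴴ-h₂⁺))

module ComposedRule {o ℓ : Level} (𝒞 : Category o ℓ) (adhesive : Notions.Adhesive 𝒞) where
  open Notions 𝒞
  open CategoryProperties 𝒞
  open AdhesiveProperties adhesive
  open IsPullback renaming (commute to pb-commute)
  open IsFPC using (pullback)

  -- General pushouts are never formed: the objects H, L and R that need them are given.
  module _
    (_ : HasPushouts) (fpcs : HasFPCsAlongMonos)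
    {L₁ P₁ R₁ G₁ G₁⁻ G₂ : Obj}
    (r₁⁻ : Hom P₁ L₁) (r₁⁺ : Hom P₁ R₁) (m₁ : Hom L₁ G₁) (mono-m₁ : Mono m₁)
    (m₁⁻ : Hom P₁ G₁⁻) (g₁⁻ : Hom G₁⁻ G₁) (fpc₁⁻ : IsFPC r₁⁻ m₁ m₁⁻ g₁⁻)
    (g₁⁺ : Hom G₁⁻ G₂) (m₁⁺ : Hom R₁ G₂) (po₁⁺ : IsPushout m₁⁻ r₁⁺ g₁⁺ m₁⁺)
    (po₁⁻ : IsPushout r₁⁻ m₁⁻ m₁ g₁⁻) (fpc₁⁺ : IsFPC r₁⁺ m₁⁺ m₁⁻ g₁⁺)
    {L₂ P₂ R₂ G₂⁻ G₃ : Obj}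
    (r₂⁻ : Hom P₂ L₂) (r₂⁺ : Hom P₂ R₂) (m₂ : Hom L₂ G₂) (mono-m₂ : Mono m₂)
    (m₂⁻ : Hom P₂ G₂⁻) (g₂⁻ : Hom G₂⁻ G₂) (fpc₂⁻ : IsFPC r₂⁻ m₂ m₂⁻ g₂⁻)
    (g₂⁺ : Hom G₂⁻ G₃) (m₂⁺ : Hom R₂ G₃) (po₂⁺ : IsPushout m₂⁻ r₂⁺ g₂⁺ m₂⁺)
    {D : Obj} (x : Hom D R₁) (y : Hom D L₂) (pb-D : IsPullback m₁⁺ m₂ x y)
    {H : Obj} (r₁ᴴ : Hom R₁ H) (l₂ᴴ : Hom L₂ H) (po-H : IsPushout x y r₁ᴴ l₂ᴴ)
    (mᴴ : Hom H G₂) (mᴴr₁ᴴ : mᴴ ∘ r₁ᴴ ≡ m₁⁺) (mᴴl₂ᴴ : mᴴ ∘ l₂ᴴ ≡ m₂)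
    {P₁ᴴ : Obj} (p₁ᴴ : Hom P₁ P₁ᴴ) (h₁⁺ : Hom P₁ᴴ H) (fpc₁ᴴ : IsFPC r₁⁺ r₁ᴴ p₁ᴴ h₁⁺)
    {P₂ᴴ : Obj} (p₂ᴴ : Hom P₂ P₂ᴴ) (h₂⁻ : Hom P₂ᴴ H) (fpc₂ᴴ : IsFPC r₂⁻ l₂ᴴ p₂ᴴ h₂⁻)
    {L : Obj} (l₁ᴴ : Hom L₁ L) (h₁⁻ : Hom P₁ᴴ L) (po-L : IsPushout r₁⁻ p₁ᴴ l₁ᴴ h₁⁻)
    {R : Obj} (r₂ᴴ : Hom R₂ R) (h₂⁺ : Hom P₂ᴴ R) (po-R : IsPushout r₂⁺ p₂ᴴ r₂ᴴ h₂⁺)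
    {P : Obj} (p′ : Hom P P₁ᴴ) (p″ : Hom P P₂ᴴ) (pb-P : IsPullback h₁⁺ h₂⁻ p′ p″)
    (m₁ᴴ : Hom P₁ᴴ G₁⁻) (m₁ᴴp₁ᴴ : m₁ᴴ ∘ p₁ᴴ ≡ m₁⁻) (g₁⁺m₁ᴴ : g₁⁺ ∘ m₁ᴴ ≡ mᴴ ∘ h₁⁺)
    (m : Hom L G₁) (ml₁ᴴ : m ∘ l₁ᴴ ≡ m₁) (mh₁⁻ : m ∘ h₁⁻ ≡ g₁⁻ ∘ m₁ᴴ)
    where

    m₁⁻-mono : Mono m₁⁻
    m₁⁻-mono = mono-pullback-stable (pullback fpc₁⁻) mono-m₁

    m₁⁺-mono : Mono m₁⁺
    m₁⁺-mono = pushout-preserves-mono m₁⁻-mono po₁⁺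

    mᴴ-mono : Mono mᴴ
    mᴴ-mono = union-mono m₁⁺-mono mono-m₂ pb-D po-H mᴴr₁ᴴ mᴴl₂ᴴ

    p₁ᴴ-mono : Mono p₁ᴴ
    p₁ᴴ-mono = mono-pullback-stable (pullback fpc₁ᴴ)
                 (mono-pullback-stable (triangle-pullback mᴴ-mono mᴴr₁ᴴ) m₁⁺-mono)

    fpc-h₁⁺ : IsFPC h₁⁺ mᴴ m₁ᴴ g₁⁺
    fpc-h₁⁺ = fpc-factor-unique fpcs fpc₁ᴴ (subst (λ c → IsFPC r₁⁺ c m₁⁻ g₁⁺) (sym mᴴr₁ᴴ) fpc₁⁺)
                mᴴ-mono m₁ᴴp₁ᴴ g₁⁺m₁ᴴ

    m₁ᴴ-mono : Mono m₁ᴴ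
    m₁ᴴ-mono = mono-pullback-stable (pullback fpc-h₁⁺) mᴴ-mono

    po-m₁ᴴ-h₁⁺ : IsPushout m₁ᴴ h₁⁺ g₁⁺ mᴴ
    po-m₁ᴴ-h₁⁺ = pushout-restrict m₁⁻-mono po₁⁺ mᴴ-mono m₁ᴴp₁ᴴ mᴴr₁ᴴ
                   (sym (pb-commute (pullback fpc₁ᴴ))) (pullback-sym (pullback fpc-h₁⁺))

    po-m₁ᴴ-h₁⁻ : IsPushout m₁ᴴ h₁⁻ g₁⁻ m
    po-m₁ᴴ-h₁⁻ = pushout-unglue (pushout-sym po-L)
                   (subst₂ (λ f i → IsPushout f r₁⁻ g₁⁻ i) (sym m₁ᴴp₁ᴴ) (sym ml₁ᴴ) (pushout-sym po₁⁻))
                   mh₁⁻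

    m-mono : Mono m
    m-mono = pushout-preserves-mono m₁ᴴ-mono po-m₁ᴴ-h₁⁻

    fpc-h₁⁻ : IsFPC h₁⁻ m m₁ᴴ g₁⁻
    fpc-h₁⁻ = fpc-cancel fpcs m-mono (pushout-along-mono-is-pullback p₁ᴴ-mono (pushout-sym po-L))
                (pullback-sym (pushout-along-mono-is-pullback m₁ᴴ-mono po-m₁ᴴ-h₁⁻))
                (subst₂ (λ c a → IsFPC r₁⁻ c a g₁⁻) (sym ml₁ᴴ) (sym m₁ᴴp₁ᴴ) fpc₁⁻)

    split-fpc₂⁻ : Σ (Hom P₂ᴴ G₂⁻) λ m₂ᴴ → (m₂ᴴ ∘ p₂ᴴ ≡ m₂⁻) × IsFPC h₂⁻ mᴴ m₂ᴴ g₂⁻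
    split-fpc₂⁻ = fpc-factor fpcs fpc₂ᴴ (subst (λ c → IsFPC r₂⁻ c m₂⁻ g₂⁻) (sym mᴴl₂ᴴ) fpc₂⁻) mᴴ-mono

    m₂ᴴ : Hom P₂ᴴ G₂⁻
    m₂ᴴ = proj₁ split-fpc₂⁻

    fpc-h₂⁻ : IsFPC h₂⁻ mᴴ m₂ᴴ g₂⁻
    fpc-h₂⁻ = proj₂ (proj₂ split-fpc₂⁻)

    split-po₂⁺ : Σ (Hom R G₃) λ m⁺ → (m⁺ ∘ r₂ᴴ ≡ m₂⁺) × IsPushout m₂ᴴ h₂⁺ g₂⁺ m⁺
    split-po₂⁺ = pushout-unglue-induced po-R
                   (subst (λ f → IsPushout f r₂⁺ g₂⁺ m₂⁺) (sym (proj₁ (proj₂ split-fpc₂⁻))) po₂⁺)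

    composed-rewrite :
      Mono m ×
      Σ Obj λ G₁⊖ → Σ (Hom G₁⊖ G₁) λ g⁻ → Σ (Hom P G₁⊖) λ m⁻ →
      Σ (Hom G₁⊖ G₃) λ g⁺ → Σ (Hom R G₃) λ m⁺ →
        Mono m⁻ × Mono m⁺ ×
        IsFPC (h₁⁻ ∘ p′) m m⁻ g⁻ ×
        IsPushout m⁻ (h₂⁺ ∘ p″) g⁺ m⁺
    composed-rewrite =
      let (G₁⊖ , g⁻ , m⁻ , g⁺ , m⁻-mono , fpc , po) =
            concurrent-composition fpc-h₁⁻ m₁ᴴ-mono po-m₁ᴴ-h₁⁺ fpc-h₂⁻ (proj₂ (proj₂ split-po₂⁺)) pb-P
      in m-mono , G₁⊖ , g⁻ , m⁻ , g⁺ , proj₁ split-po₂⁺ ,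
         m⁻-mono , pushout-preserves-mono m⁻-mono po , fpc , po

theorem1 : {o ℓ : Level} (𝒞 : Category o ℓ) →
  let open Notions 𝒞 in
  Adhesive → HasPushouts → HasFPCsAlongMonos →
  -- first rule, instance, and its SqPO rewriting G₁ ⇒ G₂
  ∀ {L₁ P₁ R₁ G₁ G₁⁻ G₂}
    (r₁⁻ : Hom P₁ L₁) (r₁⁺ : Hom P₁ R₁) (m₁ : Hom L₁ G₁) → Mono m₁ →
  ∀ (m₁⁻ : Hom P₁ G₁⁻) (g₁⁻ : Hom G₁⁻ G₁) → IsFPC r₁⁻ m₁ m₁⁻ g₁⁻ →
  ∀ (g₁⁺ : Hom G₁⁻ G₂) (m₁⁺ : Hom R₁ G₂) → IsPushout m₁⁻ r₁⁺ g₁⁺ m₁⁺ →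
  -- reversibility of the first rewriting
  IsPushout r₁⁻ m₁⁻ m₁ g₁⁻ → IsFPC r₁⁺ m₁⁺ m₁⁻ g₁⁺ →
  -- second rule, instance, and its SqPO rewriting G₂ ⇒ G₃
  ∀ {L₂ P₂ R₂ G₂⁻ G₃}
    (r₂⁻ : Hom P₂ L₂) (r₂⁺ : Hom P₂ R₂) (m₂ : Hom L₂ G₂) → Mono m₂ →
  ∀ (m₂⁻ : Hom P₂ G₂⁻) (g₂⁻ : Hom G₂⁻ G₂) → IsFPC r₂⁻ m₂ m₂⁻ g₂⁻ →
  ∀ (g₂⁺ : Hom G₂⁻ G₃) (m₂⁺ : Hom R₂ G₃) → IsPushout m₂⁻ r₂⁺ g₂⁺ m₂⁺ →
  -- (1) the overlap: pullback of m₁⁺ and m₂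
  ∀ {D} (x : Hom D R₁) (y : Hom D L₂) → IsPullback m₁⁺ m₂ x y →
  -- (2) pushout of x and y, and the induced arrow m^H
  ∀ {H} (r₁ᴴ : Hom R₁ H) (l₂ᴴ : Hom L₂ H) → IsPushout x y r₁ᴴ l₂ᴴ →
  ∀ (mᴴ : Hom H G₂) → mᴴ ∘ r₁ᴴ ≡ m₁⁺ → mᴴ ∘ l₂ᴴ ≡ m₂ →
  -- (3) final pullback complements
  ∀ {P₁ᴴ} (p₁ᴴ : Hom P₁ P₁ᴴ) (h₁⁺ : Hom P₁ᴴ H) → IsFPC r₁⁺ r₁ᴴ p₁ᴴ h₁⁺ →
  ∀ {P₂ᴴ} (p₂ᴴ : Hom P₂ P₂ᴴ) (h₂⁻ : Hom P₂ᴴ H) → IsFPC r₂⁻ l₂ᴴ p₂ᴴ h₂⁻ →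
  -- (4) pushouts
  ∀ {L} (l₁ᴴ : Hom L₁ L) (h₁⁻ : Hom P₁ᴴ L) → IsPushout r₁⁻ p₁ᴴ l₁ᴴ h₁⁻ →
  ∀ {R} (r₂ᴴ : Hom R₂ R) (h₂⁺ : Hom P₂ᴴ R) → IsPushout r₂⁺ p₂ᴴ r₂ᴴ h₂⁺ →
  -- (5) pullback of h₁⁺ and h₂⁻
  ∀ {P} (p′ : Hom P P₁ᴴ) (p″ : Hom P P₂ᴴ) → IsPullback h₁⁺ h₂⁻ p′ p″ →
  -- the induced arrows m₁ᴴ and m
  ∀ (m₁ᴴ : Hom P₁ᴴ G₁⁻) → m₁ᴴ ∘ p₁ᴴ ≡ m₁⁻ → g₁⁺ ∘ m₁ᴴ ≡ mᴴ ∘ h₁⁺ →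
  ∀ (m : Hom L G₁) → m ∘ l₁ᴴ ≡ m₁ → m ∘ h₁⁻ ≡ g₁⁻ ∘ m₁ᴴ →
  -- conclusion: m is an instance, and SqPO rewriting of G₁ by the composed
  -- rule  L ← P → R  through m produces G₃
  Mono m ×
  Σ Obj λ G₁⊖ → Σ (Hom G₁⊖ G₁) λ g⁻ → Σ (Hom P G₁⊖) λ m⁻ →
  Σ (Hom G₁⊖ G₃) λ g⁺ → Σ (Hom R G₃) λ m⁺ →
    Mono m⁻ × Mono m⁺ ×
    IsFPC (h₁⁻ ∘ p′) m m⁻ g⁻ ×
    IsPushout m⁻ (h₂⁺ ∘ p″) g⁺ m⁺
theorem1 𝒞 = ComposedRule.composed-rewrite 𝒞
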